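{- Let $w\in\mathfrak{S}_n$ avoid the six patterns $3412$, $4231$, $34521$, $45321$, $54123$, $54312$, let $t=t(w)$, and let $J=\{s_1,\dots,s_t\}\subseteq S=\{s_1,\dots,s_{n-1}\}$. Then: (i) If $w$ is of type n, then $w\,w_0(J)=w_0(J)\,w$ lies in the parabolic subgroup generated by $(S\setminus J)\setminus\{s_{t+1}\}$, and viewed as a permutation of size $n-t-1$ it avoids the six patterns. (ii) If $w$ is of type r$_0$, then $w_0(J)\,w$ lies in the parabolic subgroup generated by $S\setminus J$, and viewed as a permutation of size $n-t$ it avoids the six patterns. (iii) If $w$ is of type r$_1$, then $w'=s_t\,w_0(J)\,w$ lies in the parabolic subgroup generated by $(S\setminus J)\cup\{s_t\}$, and viewed as a permutation of size $n-t+1$ it avoids the six patterns; moreover, as a permutation in $\mathfrak{S}_{n-t+1}$, $t(w')=|R_1|+1$ and $w'$ is not of type r$_1$, and if $|R_1|=1$ then $w'$ is not of type l$_1$ either.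
   Context: Permutations are multiplied as functions, $(uv)(i)=u(v(i))$; $s_i=(i\ i+1)$; for $J\subseteq S$, $w_0(J)$ is the longest element of the subgroup generated by $J$ (for $J=\{s_1,\dots,s_t\}$ it reverses $1,\dots,t+1$; $w_0(\emptyset)=e$). If $u(i)=i$ for $i\le m$, then $u$ lies in the subgroup generated by $\{s_{m+1},\dots,s_{n-1}\}$ and is identified with the permutation of $\{1,\dots,n-m\}$ given by $i\mapsto u(i+m)-m$. Pattern avoidance: $w$ avoids $\pi\in\mathfrak{S}_m$ if no indices $i_1<\dots<i_m$ have $w(i_1),\dots,w(i_m)$ in the same relative order as $\pi(1),\dots,\pi(m)$. For $w\in\mathfrak{S}_n$ let $C=\{(a,w(a)):1\le a\le w^{ -1}(1),\ 1\le w(a)\le w(1)\}$ and $t(w)=|C|-1$; write the elements of $C$ as $(c_0,w(c_0)),\dots,(c_t,w(c_t))$ with $1=c_0<\dots<c_t=w^{ -1}(1)$. Let $R=\{(a,w(a)):1<a<w^{ -1}(1),\ w(a)>w(1)\}$ and $L=\{(a,w(a)):a>w^{ -1}(1),\ 1<w(a)<w(1)\}$ (for $w$ avoiding $3412$ at most one of these is nonempty). $w$ is of type n if $L=R=\emptyset$, of type r if $R\ne\emptyset$, and of type l if $L\neq\emptyset$. Let $R_1=\{(a,w(a))\in R: c_{t-2}<a<c_{t-1}\}$ (empty if $t\le 1$). A permutation of type r is of type r$_1$ if $R_1\ne\emptyset$ and of type r$_0$ if $R_1=\emptyset$. $w$ is of type l$_i$ ($i\in\{0,1\}$) if $w^{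 -1}$ is of type r$_i$. -}

module Defs where

open import Data.Bool using (Bool; true; false; _∧_; if_then_else_; T)
open import Data.Nat using (ℕ; zero; suc; _∸_; _<_; _≤_; _<ᵇ_; _≤ᵇ_; _≡ᵇ_)
open import Data.Fin using (Fin; toℕ)
import Data.Fin as F
open import Data.Fin.Permutation using (Permutation′; _⟨$⟩ʳ_; _⟨$⟩ˡ_; flip)
open import Data.List using (List; []; _∷_; length; filterᵇ; allFin)
open import Data.Maybe using (Maybe; just; nothing)
open import Data.Vec using (Vec; lookup) renaming (_∷_ to _∷v_; [] to []v)
open import Data.Product using (Σ; ∃; _×_)
open import Data.Empty using (⊥)
open import Relation.Nullary using (¬_)
open import Relation.Binary.PropositionalEquality using (_≡_)
open import Function using (_⇔_)

-- Conventions: a permutation w ∈ 𝔖_k is a  Permutation′ k  (bijection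
-- Fin k ↔ Fin k).  Everything is 0-based: position/value i (Fin) stands
-- for the paper's i+1.

count : ∀ {k} → (Fin k → Bool) → ℕ
count {k} P = length (filterᵇ P (allFin k))

nth : ∀ {A : Set} → List A → ℕ → Maybe A
nth []       _       = nothing
nth (x ∷ xs) zero    = just x
nth (x ∷ xs) (suc j) = nth xs j

-- Pattern containment / avoidance.  A pattern π ∈ 𝔖_m is given in
-- one-line notation as a vector of its values π(1),…,π(m).

Contains : ∀ {n m} → Permutation′ n → Vec ℕ m → Set
Contains {n} {m} w π =
  Σ (Fin m → Fin n) λ f →
    (∀ i j → i F.< j → f i F.< f j) ×
    (∀ i j → (lookup π i < lookup π j) ⇔ ((w ⟨$⟩ʳ f i) F.< (w ⟨$⟩ʳ f j)))

Avoids : ∀ {n m} → Permutation′ n → Vec ℕ m → Set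
Avoids w π = ¬ Contains w π

p3412 p4231 : Vec ℕ 4
p3412 = 3 ∷v 4 ∷v 1 ∷v 2 ∷v []v
p4231 = 4 ∷v 2 ∷v 3 ∷v 1 ∷v []v

p34521 p45321 p54123 p54312 : Vec ℕ 5
p34521 = 3 ∷v 4 ∷v 5 ∷v 2 ∷v 1 ∷v []v
p45321 = 4 ∷v 5 ∷v 3 ∷v 2 ∷v 1 ∷v []v
p54123 = 5 ∷v 4 ∷v 1 ∷v 2 ∷v 3 ∷v []v
p54312 = 5 ∷v 4 ∷v 3 ∷v 1 ∷v 2 ∷v []v

AvoidsSix : ∀ {n} → Permutation′ n → Set
AvoidsSix w = Avoids w p3412 × Avoids w p4231 × Avoids w p34521 ×
              Avoids w p45321 × Avoids w p54123 × Avoids w p54312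

module _ {k : ℕ} (w : Permutation′ (suc k)) where
  -- paper's w(1) - 1  and  w⁻¹(1) - 1
  wOne : ℕ
  wOne = toℕ (w ⟨$⟩ʳ F.zero)
  posOne : ℕ
  posOne = toℕ (w ⟨$⟩ˡ F.zero)

  inCᵇ : Fin (suc k) → Bool
  inCᵇ a = (toℕ a ≤ᵇ posOne) ∧ (toℕ (w ⟨$⟩ʳ a) ≤ᵇ wOne)

  -- c₀ < c₁ < … < c_t : the positions of C in increasing order
  Cs : List (Fin (suc k))
  Cs = filterᵇ inCᵇ (allFin (suc k))

  t⁺ : ℕ
  t⁺ = length Cs ∸ 1

  inRᵇ : Fin (suc k) → Bool
  inRᵇ a = (0 <ᵇ toℕ a) ∧ ((toℕ a <ᵇ posOne) ∧ (wOne <ᵇ toℕ (w ⟨$⟩ʳ a)))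

  inLᵇ : Fin (suc k) → Bool
  inLᵇ a = (posOne <ᵇ toℕ a) ∧ ((0 <ᵇ toℕ (w ⟨$⟩ʳ a)) ∧ (toℕ (w ⟨$⟩ʳ a) <ᵇ wOne))

  private
    between : Maybe (Fin (suc k)) → Maybe (Fin (suc k)) → Fin (suc k) → Bool
    between (just b) (just c) a = (toℕ b <ᵇ toℕ a) ∧ (toℕ a <ᵇ toℕ c)
    between _        _        a = false

  inR₁ᵇ : Fin (suc k) → Bool
  inR₁ᵇ a = inRᵇ a ∧ ((2 ≤ᵇ t⁺) ∧ between (nth Cs (t⁺ ∸ 2)) (nth Cs (t⁺ ∸ 1)) a)

-- t(w), for w ∈ 𝔖_k (k = 0 is degenerate; set to 0)
tOf : ∀ {k} → Permutation′ k → ℕ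
tOf {zero}  w = 0
tOf {suc k} w = t⁺ w

cardR₁ : ∀ {k} → Permutation′ k → ℕ
cardR₁ {zero}  w = 0
cardR₁ {suc k} w = count (inR₁ᵇ w)

TypeN : ∀ {k} → Permutation′ k → Set
TypeN {zero}  w = ⊥
TypeN {suc k} w = (∀ a → ¬ T (inRᵇ w a)) × (∀ a → ¬ T (inLᵇ w a))

TypeR : ∀ {k} → Permutation′ k → Set
TypeR {zero}  w = ⊥
TypeR {suc k} w = ∃ λ a → T (inRᵇ w a)

TypeR₁ : ∀ {k} → Permutation′ k → Set
TypeR₁ {zero}  w = ⊥
TypeR₁ {suc k} w = ∃ λ a → T (inR₁ᵇ w a)

TypeR₀ : ∀ {k} → Permutation′ k → Set
TypeR₀ w = TypeR w × ¬ TypeR₁ w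

TypeL₁ : ∀ {k} → Permutation′ k → Set
TypeL₁ w = TypeR₁ (flip w)

-- The permutations w₀(J) (J = {s₁,…,s_t}) and s_j, acting on values
-- (0-based, on ℕ; they are the identity beyond the relevant range).

-- w₀({s₁,…,s_t}) reverses 1,…,t+1 (0-based: 0,…,t)
w₀ : ℕ → ℕ → ℕ
w₀ t x = if x ≤ᵇ t then t ∸ x else x

-- s_j = (j j+1), 1-based; 0-based it swaps j-1 and j  (used for j ≥ 1)
sₜ : ℕ → ℕ → ℕ
sₜ j x = if x ≡ᵇ (j ∸ 1) then j else (if x ≡ᵇ j then j ∸ 1 else x)

-- u ∈ 𝔖_N (given by its values u : Fin N → ℕ) fixes 1,…,m, i.e. lies in
-- the parabolic subgroup generated by {s_{m+1},…,s_{N-1}}, and v ∈ 𝔖_{N-m}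
-- is u viewed as a permutation of size N-m:  v(i) = u(i+m) - m.
RestrictsTo : ∀ {N K} → ℕ → (Fin N → ℕ) → Permutation′ K → Set
RestrictsTo {N} {K} m u v =
  (∀ (i : Fin N) → toℕ i < m → u i ≡ toℕ i) ×
  (∀ (i : Fin N) (j : Fin K) → toℕ i ≡ toℕ j Data.Nat.+ m → u i ≡ toℕ (v ⟨$⟩ʳ j) Data.Nat.+ m)

-- Avoiding 4231 makes the values of w decrease along C, and avoiding 3412 forbids R and L
-- to be nonempty together.  In types n and r therefore L = ∅, which makes C the set of
-- positions carrying the values 1, …, w(1); so t = w(1) − 1 and C is ordered by decreasing
-- value.  Let c = w⁻¹(1), w⁻¹(2), w⁻¹(3) in types n, r₀, r₁.  Every position before c lies
-- in C (in type r₁ by 45321-avoidance, in type r₀ because R₁ = ∅), so w starts with the run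
-- w(1), w(1) − 1, …, w(c), and every later value is below w(c) or above w(1).  Multiplying
-- by w₀(J), and then by s_t in type r₁, turns this run into 1, …, c and is increasing on the
-- remaining values; the rest of the permutation is therefore order-isomorphic to a part of w
-- and inherits the avoidance.  In type r₁ the block R₁ becomes the start of w′, and 34521- and
-- 4231-avoidance give C(w′) = {1, …, |R₁| + 1} ∪ {w′⁻¹(1)}: hence t(w′) = |R₁| + 1, and the
-- last two elements of C(w′) before w′⁻¹(1) are adjacent, leaving no room for R₁(w′); when
-- |R₁| = 1 the same happens for w′⁻¹.

module Submission where

open import Defs
open import Data.Bool using (Bool; true; false; _∧_; not; if_then_else_; T)
open import Data.Bool.Properties using (T-∧; T-≡)
open import Data.Nat
open import Data.Nat.Properties
open import Data.Fin as F using (Fin; toℕ; fromℕ<)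
import Data.Fin.Properties as FP
open import Data.Fin.Patterns using (0F; 1F; 2F; 3F; 4F)
open import Data.Fin.Permutation
  using (Permutation′; _⟨$⟩ʳ_; _⟨$⟩ˡ_; inverseˡ; inverseʳ; flip; permutation; remove; punchIn-permute; _∘ₚ_)
open import Data.List using (List; []; _∷_; length; map; filterᵇ; allFin; tabulate)
open import Data.List.Properties using (map-tabulate; length-map; filter-≐)
open import Data.Maybe using (Maybe; just)
import Data.Maybe as Maybe
open import Data.Vec as Vec using (Vec; lookup; []; _∷_)
open import Data.Vec.Properties using (lookup-map)
open import Data.Vec.Relation.Unary.Linked using (Linked; [-]; _∷_)
open import Data.Vec.Relation.Unary.Linked.Properties using (lookup⁺)
open import Data.Product using (Σ; _×_; _,_; proj₁; proj₂)
open import Data.Product.Function.NonDependent.Propositional using (_×-⇔_)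
open import Data.Sum using (_⊎_; inj₁; inj₂; [_,_]′; map₁)
open import Data.Empty using (⊥; ⊥-elim)
open import Relation.Nullary using (¬_; yes; no)
open import Relation.Nullary.Decidable using (T?)
open import Relation.Binary using (tri<; tri≈; tri>)
open import Relation.Binary.PropositionalEquality
open import Function using (_∘_; id; _⇔_; mk⇔; Equivalence)
open import Function.Properties.Equivalence using () renaming (trans to ⇔-trans; refl to ⇔-refl; sym to ⇔-sym)
open import Algebra.Properties.CommutativeMonoid.Sum +-0-commutativeMonoid using (sum; sum-cong-≗; sum-permute; ∑-distrib-+)

open Equivalence using (to; from)

T-≤ᵇ : ∀ {m n} → T (m ≤ᵇ n) ⇔ m ≤ n
T-≤ᵇ {m} {n} = mk⇔ (≤ᵇ⇒≤ m n) ≤⇒≤ᵇ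

T-<ᵇ : ∀ {m n} → T (m <ᵇ n) ⇔ m < n
T-<ᵇ {m} {n} = mk⇔ (<ᵇ⇒< m n) <⇒<ᵇ

T-not : ∀ {b} → T (not b) ⇔ (¬ T b)
T-not {true}  = mk⇔ (λ ()) (λ ¬t → ¬t _)
T-not {false} = mk⇔ (λ _ ()) (λ _ → _)

¬T⇒≡false : ∀ {b} → ¬ T b → b ≡ false
¬T⇒≡false {false} _  = refl
¬T⇒≡false {true}  ¬b = ⊥-elim (¬b _)

val : ∀ {n} → Permutation′ n → Fin n → ℕ
val w x = toℕ (w ⟨$⟩ʳ x)

val-injective : ∀ {N} (w : Permutation′ N) {x y} → val w x ≡ val w y → x ≡ y
val-injective w {x} {y} e =
  trans (sym (inverseˡ w)) (trans (cong (w ⟨$⟩ˡ_) (FP.toℕ-injective e)) (inverseˡ w))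

indicator : Bool → ℕ
indicator b = if b then 1 else 0

filterᵇ-map : ∀ {A B : Set} (P : B → Bool) (f : A → B) (xs : List A) →
  filterᵇ P (map f xs) ≡ map f (filterᵇ (P ∘ f) xs)
filterᵇ-map P f [] = refl
filterᵇ-map P f (x ∷ xs) with P (f x)
... | true  = cong (f x ∷_) (filterᵇ-map P f xs)
... | false = filterᵇ-map P f xs

filterᵇ-tabulate-suc : ∀ {k} (P : Fin (suc k) → Bool) →
  filterᵇ P (tabulate F.suc) ≡ map F.suc (filterᵇ (P ∘ F.suc) (allFin k))
filterᵇ-tabulate-suc {k} P = begin
  filterᵇ P (tabulate F.suc)              ≡⟨ cong (filterᵇ P) (map-tabulate id F.suc) ⟨
  filterᵇ P (map F.suc (allFin k))        ≡⟨ filterᵇ-map P F.suc (allFin k) ⟩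
  map F.suc (filterᵇ (P ∘ F.suc) (allFin k)) ∎
  where open ≡-Reasoning

length-filterᵇ-tabulate-suc : ∀ {k} (P : Fin (suc k) → Bool) →
  length (filterᵇ P (tabulate F.suc)) ≡ count (P ∘ F.suc)
length-filterᵇ-tabulate-suc {k} P =
  trans (cong length (filterᵇ-tabulate-suc P)) (length-map F.suc (filterᵇ (P ∘ F.suc) (allFin k)))

count-suc : ∀ {k} (P : Fin (suc k) → Bool) → count P ≡ indicator (P F.zero) + count (P ∘ F.suc)
count-suc P with P F.zero
... | true  = cong suc (length-filterᵇ-tabulate-suc P)
... | false = length-filterᵇ-tabulate-suc P

count-cong : ∀ {k} {P Q : Fin k → Bool} → (∀ i → T (P i) ⇔ T (Q i)) → count P ≡ count Q
count-cong {k} {P} {Q} P⇔Q =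
  cong length (filter-≐ (T? ∘ P) (T? ∘ Q) ((λ {i} → to (P⇔Q i)) , (λ {i} → from (P⇔Q i))) (allFin k))

count≡sum : ∀ {k} (P : Fin k → Bool) → count P ≡ sum (indicator ∘ P)
count≡sum {zero}  P = refl
count≡sum {suc k} P = trans (count-suc P) (cong (indicator (P F.zero) +_) (count≡sum (P ∘ F.suc)))

count-permute : ∀ {k} (P : Fin k → Bool) (π : Permutation′ k) → count (P ∘ (π ⟨$⟩ʳ_)) ≡ count P
count-permute P π = begin
  count (P ∘ (π ⟨$⟩ʳ_))            ≡⟨ count≡sum (P ∘ (π ⟨$⟩ʳ_)) ⟩
  sum (indicator ∘ P ∘ (π ⟨$⟩ʳ_))  ≡⟨ sum-permute (indicator ∘ P) π ⟨
  sum (indicator ∘ P)              ≡⟨ count≡sum P ⟨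
  count P                          ∎
  where open ≡-Reasoning

indicator-T : ∀ {b} → T b → indicator b ≡ 1
indicator-T {true} _ = refl

indicator-¬T : ∀ {b} → ¬ T b → indicator b ≡ 0
indicator-¬T {true}  ¬b = ⊥-elim (¬b _)
indicator-¬T {false} _  = refl

≤-suc⇔pred-≤ : ∀ {m n} → m ≤ suc n ⇔ m ∸ 1 ≤ n
≤-suc⇔pred-≤ {zero}  = mk⇔ (λ _ → z≤n) (λ _ → z≤n)
≤-suc⇔pred-≤ {suc m} = mk⇔ s≤s⁻¹ s≤s

suc-<⇔<-pred : ∀ {m n} → suc m < n ⇔ m < n ∸ 1
suc-<⇔<-pred {n = zero}  = mk⇔ (λ ()) (λ ())
suc-<⇔<-pred {n = suc n} = mk⇔ s<s⁻¹ s<s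

count-interval : ∀ {k} (P : Fin k → Bool) {lo hi} → lo ≤ hi → hi ≤ k →
  (∀ i → T (P i) ⇔ (lo ≤ toℕ i × toℕ i < hi)) → count P ≡ hi ∸ lo
count-interval {zero}  P z≤n z≤n _ = refl
count-interval {suc k} P {lo} {hi} lo≤hi hi≤k P⇔ = begin
  count P                                         ≡⟨ count-suc P ⟩
  indicator (P F.zero) + count (P ∘ F.suc)        ≡⟨ cong (indicator (P F.zero) +_) tail-count ⟩
  indicator (P F.zero) + (hi ∸ 1 ∸ (lo ∸ 1))      ≡⟨ head-count lo hi lo≤hi (P⇔ F.zero) ⟩
  hi ∸ lo                                         ∎
  where
  open ≡-Reasoning
  tail-count : count (P ∘ F.suc) ≡ hi ∸ 1 ∸ (lo ∸ 1)
  tail-count = count-interval (P ∘ F.suc) (∸-monoˡ-≤ 1 lo≤hi) (∸-monoˡ-≤ 1 hi≤k)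
    (λ i → ⇔-trans (P⇔ (F.suc i)) (≤-suc⇔pred-≤ ×-⇔ suc-<⇔<-pred))
  head-count : ∀ {b} lo hi → lo ≤ hi → T b ⇔ (lo ≤ 0 × 0 < hi) →
    indicator b + (hi ∸ 1 ∸ (lo ∸ 1)) ≡ hi ∸ lo
  head-count zero    zero    _ b⇔ = cong (_+ 0) (indicator-¬T (λ b → n≮0 (proj₂ (to b⇔ b))))
  head-count zero    (suc h) _ b⇔ = cong (_+ h) (indicator-T (from b⇔ (z≤n , z<s)))
  head-count (suc l) (suc h) _ b⇔ = cong (_+ (h ∸ l)) (indicator-¬T (λ b → n≮0 (proj₁ (to b⇔ b))))

count-none : ∀ {k} (P : Fin k → Bool) → (∀ i → ¬ T (P i)) → count P ≡ 0
count-none P ¬P = count-interval P z≤n z≤n (λ i → mk⇔ (⊥-elim ∘ ¬P i) (λ ()))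

nth-map : ∀ {A B : Set} (f : A → B) (xs : List A) n → nth (map f xs) n ≡ Maybe.map f (nth xs n)
nth-map f []       n       = refl
nth-map f (x ∷ xs) zero    = refl
nth-map f (x ∷ xs) (suc n) = nth-map f xs n

nth-filterᵇ-allFin : ∀ {k} (P : Fin k → Bool) (x : Fin k) → T (P x) →
  nth (filterᵇ P (allFin k)) (count (λ y → (toℕ y <ᵇ toℕ x) ∧ P y)) ≡ just x

nth-filterᵇ-tabulate-suc : ∀ {k} (P : Fin (suc k) → Bool) (x : Fin k) → T (P (F.suc x)) →
  nth (filterᵇ P (tabulate F.suc)) (count (λ y → (toℕ y <ᵇ toℕ x) ∧ P (F.suc y))) ≡ just (F.suc x)
nth-filterᵇ-tabulate-suc P x Px = begin
  nth (filterᵇ P (tabulate F.suc)) r                 ≡⟨ cong (λ xs → nth xs r) (filterᵇ-tabulate-suc P) ⟩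
  nth (map F.suc Cs′) r                              ≡⟨ nth-map F.suc Cs′ r ⟩
  Maybe.map F.suc (nth Cs′ r)                        ≡⟨ cong (Maybe.map F.suc) (nth-filterᵇ-allFin (P ∘ F.suc) x Px) ⟩
  just (F.suc x)                                     ∎
  where
  open ≡-Reasoning
  r : ℕ
  r = count (λ y → (toℕ y <ᵇ toℕ x) ∧ P (F.suc y))
  Cs′ : List (Fin _)
  Cs′ = filterᵇ (P ∘ F.suc) (allFin _)

nth-filterᵇ-allFin P F.zero Px
  rewrite count-none (λ y → (toℕ y <ᵇ 0) ∧ P y) (λ y ()) | to T-≡ Px = refl
nth-filterᵇ-allFin P (F.suc x) Px
  rewrite count-suc (λ y → (toℕ y <ᵇ toℕ (F.suc x)) ∧ P y) with P F.zero
... | true  = nth-filterᵇ-tabulate-suc P x Px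
... | false = nth-filterᵇ-tabulate-suc P x Px

count-val-interval : ∀ {k} (w : Permutation′ k) (P : Fin k → Bool) {lo hi} → lo ≤ hi → hi ≤ k →
  (∀ i → T (P i) ⇔ (lo ≤ toℕ (w ⟨$⟩ʳ i) × toℕ (w ⟨$⟩ʳ i) < hi)) → count P ≡ hi ∸ lo
count-val-interval {k} w P {lo} {hi} lo≤hi hi≤k P⇔ = begin
  count P                 ≡⟨ count-cong (λ i → ⇔-trans (P⇔ i) (⇔-sym (I⇔ (w ⟨$⟩ʳ i)))) ⟩
  count (I ∘ (w ⟨$⟩ʳ_))   ≡⟨ count-permute I w ⟩
  count I                 ≡⟨ count-interval I lo≤hi hi≤k I⇔ ⟩
  hi ∸ lo                 ∎
  where
  open ≡-Reasoning
  I : Fin k → Bool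
  I y = (lo ≤ᵇ toℕ y) ∧ (toℕ y <ᵇ hi)
  I⇔ : ∀ y → T (I y) ⇔ (lo ≤ toℕ y × toℕ y < hi)
  I⇔ y = ⇔-trans T-∧ (T-≤ᵇ ×-⇔ T-<ᵇ)

count-prefix : ∀ {k} (P : Fin k → Bool) (x : Fin k) → (∀ y → y F.< x → T (P y)) →
  count (λ y → (toℕ y <ᵇ toℕ x) ∧ P y) ≡ toℕ x
count-prefix P x prefix = count-interval _ z≤n (<⇒≤ (FP.toℕ<n x)) λ y → mk⇔
  (λ t → z≤n , to T-<ᵇ (proj₁ (to T-∧ t)))
  (λ (_ , y<x) → from T-∧ (from T-<ᵇ y<x , prefix y y<x))

nth-filterᵇ-allFin-prefix : ∀ {k} (P : Fin k → Bool) (x : Fin k) → (∀ y → toℕ y ≤ toℕ x → T (P y)) →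
  nth (filterᵇ P (allFin k)) (toℕ x) ≡ just x
nth-filterᵇ-allFin-prefix P x prefix =
  subst (λ r → nth (filterᵇ P (allFin _)) r ≡ just x) (count-prefix P x (λ y → prefix y ∘ <⇒≤))
    (nth-filterᵇ-allFin P x (prefix x ≤-refl))

indicator-split : ∀ a b → indicator a ≡ indicator (a ∧ b) + indicator (a ∧ not b)
indicator-split true  true  = refl
indicator-split true  false = refl
indicator-split false _     = refl

count-split : ∀ {k} (P Q : Fin k → Bool) →
  count P ≡ count (λ i → P i ∧ Q i) + count (λ i → P i ∧ not (Q i))
count-split P Q = begin
  count P                                   ≡⟨ count≡sum P ⟩
  sum (indicator ∘ P)                       ≡⟨ sum-cong-≗ (λ i → indicator-split (P i) (Q i)) ⟩
  sum (λ i → indicator (P∧Q i) + indicator (P∧¬Q i))   ≡⟨ ∑-distrib-+ (indicator ∘ P∧Q) (indicator ∘ P∧¬Q) ⟩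
  sum (indicator ∘ P∧Q) + sum (indicator ∘ P∧¬Q)        ≡⟨ cong₂ _+_ (count≡sum P∧Q) (count≡sum P∧¬Q) ⟨
  count P∧Q + count P∧¬Q                    ∎
  where
  open ≡-Reasoning
  P∧Q P∧¬Q : Fin _ → Bool
  P∧Q i = P i ∧ Q i
  P∧¬Q i = P i ∧ not (Q i)

strictMono-reflects-< : ∀ {m} {g : Fin m → ℕ} → (∀ {i j} → i F.< j → g i < g j) →
  ∀ {i j} → g i < g j → i F.< j
strictMono-reflects-< mono {i} {j} gi<gj with FP.<-cmp i j
... | tri< i<j _ _ = i<j
... | tri≈ _ refl _ = ⊥-elim (<-irrefl refl gi<gj)
... | tri> _ _ j<i = ⊥-elim (<-asym gi<gj (mono j<i))

-- Patterns are written ρ + 1 for a vector ρ of 0-based ranks, which makes the six patterns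
-- of Defs instances up to definitional equality.
occurrence : ∀ {n m} (w : Permutation′ n) (ρ : Vec (Fin m) m) (xs : Vec (Fin n) m) (ys : Vec ℕ m) →
  Linked F._<_ xs → Linked _<_ ys → (∀ i → val w (lookup xs i) ≡ lookup ys (lookup ρ i)) →
  Contains w (Vec.map (suc ∘ toℕ) ρ)
occurrence w ρ xs ys xs↑ ys↑ xs≡ys∘ρ = lookup xs , (λ i j → lookup⁺ FP.<-trans xs↑) , order
  where
  ys-mono : ∀ {a b} → a F.< b → lookup ys a < lookup ys b
  ys-mono = lookup⁺ <-trans ys↑
  order : ∀ i j → (lookup (Vec.map (suc ∘ toℕ) ρ) i < lookup (Vec.map (suc ∘ toℕ) ρ) j) ⇔
                  (val w (lookup xs i) < val w (lookup xs j))
  order i j rewrite lookup-map i (suc ∘ toℕ) ρ | lookup-map j (suc ∘ toℕ) ρ | xs≡ys∘ρ i | xs≡ys∘ρ j =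
    mk⇔ (ys-mono ∘ s<s⁻¹) (s<s ∘ strictMono-reflects-< ys-mono)

module _ {n} (w : Permutation′ n) {x₀ x₁ x₂ x₃ : Fin n} where

  contains-3412 : x₀ F.< x₁ → x₁ F.< x₂ → x₂ F.< x₃ →
    val w x₂ < val w x₃ → val w x₃ < val w x₀ → val w x₀ < val w x₁ → Contains w p3412
  contains-3412 a b c d e f = occurrence w (2F ∷ 3F ∷ 0F ∷ 1F ∷ []) (x₀ ∷ x₁ ∷ x₂ ∷ x₃ ∷ [])
    (val w x₂ ∷ val w x₃ ∷ val w x₀ ∷ val w x₁ ∷ []) (a ∷ b ∷ c ∷ [-]) (d ∷ e ∷ f ∷ [-])
    λ { 0F → refl ; 1F → refl ; 2F → refl ; 3F → refl }

  contains-4231 : x₀ F.< x₁ → x₁ F.< x₂ → x₂ F.< x₃ →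
    val w x₃ < val w x₁ → val w x₁ < val w x₂ → val w x₂ < val w x₀ → Contains w p4231
  contains-4231 a b c d e f = occurrence w (3F ∷ 1F ∷ 2F ∷ 0F ∷ []) (x₀ ∷ x₁ ∷ x₂ ∷ x₃ ∷ [])
    (val w x₃ ∷ val w x₁ ∷ val w x₂ ∷ val w x₀ ∷ []) (a ∷ b ∷ c ∷ [-]) (d ∷ e ∷ f ∷ [-])
    λ { 0F → refl ; 1F → refl ; 2F → refl ; 3F → refl }

  module _ {x₄ : Fin n} where

    contains-34521 : x₀ F.< x₁ → x₁ F.< x₂ → x₂ F.< x₃ → x₃ F.< x₄ →
      val w x₄ < val w x₃ → val w x₃ < val w x₀ → val w x₀ < val w x₁ → val w x₁ < val w x₂ →
      Contains w p34521
    contains-34521 a b c d e f g h = occurrence w (2F ∷ 3F ∷ 4F ∷ 1F ∷ 0F ∷ [])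
      (x₀ ∷ x₁ ∷ x₂ ∷ x₃ ∷ x₄ ∷ []) (val w x₄ ∷ val w x₃ ∷ val w x₀ ∷ val w x₁ ∷ val w x₂ ∷ [])
      (a ∷ b ∷ c ∷ d ∷ [-]) (e ∷ f ∷ g ∷ h ∷ [-])
      λ { 0F → refl ; 1F → refl ; 2F → refl ; 3F → refl ; 4F → refl }

    contains-45321 : x₀ F.< x₁ → x₁ F.< x₂ → x₂ F.< x₃ → x₃ F.< x₄ →
      val w x₄ < val w x₃ → val w x₃ < val w x₂ → val w x₂ < val w x₀ → val w x₀ < val w x₁ →
      Contains w p45321
    contains-45321 a b c d e f g h = occurrence w (3F ∷ 4F ∷ 2F ∷ 1F ∷ 0F ∷ [])
      (x₀ ∷ x₁ ∷ x₂ ∷ x₃ ∷ x₄ ∷ []) (val w x₄ ∷ val w x₃ ∷ val w x₂ ∷ val w x₀ ∷ val w x₁ ∷ [])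
      (a ∷ b ∷ c ∷ d ∷ [-]) (e ∷ f ∷ g ∷ h ∷ [-])
      λ { 0F → refl ; 1F → refl ; 2F → refl ; 3F → refl ; 4F → refl }

-- Restricting to a parabolic subgroup

contains-transfer : ∀ {K N m} {v : Permutation′ K} {w : Permutation′ N} (s : Fin K → Fin N) →
  (∀ {i j} → i F.< j → s i F.< s j) → (∀ i j → (val v i < val v j) ⇔ (val w (s i) < val w (s j))) →
  (π : Vec ℕ m) → Contains v π → Contains w π
contains-transfer s s↑ s-order π (f , f↑ , f-order) =
  s ∘ f , (λ i j → s↑ ∘ f↑ i j) , λ i j → ⇔-trans (f-order i j) (s-order (f i) (f j))

avoidsSix-transfer : ∀ {K N} {v : Permutation′ K} {w : Permutation′ N} (s : Fin K → Fin N) →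
  (∀ {i j} → i F.< j → s i F.< s j) → (∀ i j → (val v i < val v j) ⇔ (val w (s i) < val w (s j))) →
  AvoidsSix w → AvoidsSix v
avoidsSix-transfer {v = v} {w} s s↑ s-order (a₁ , a₂ , a₃ , a₄ , a₅ , a₆) =
  a₁ ∘ transfer p3412 , a₂ ∘ transfer p4231 , a₃ ∘ transfer p34521 ,
  a₄ ∘ transfer p45321 , a₅ ∘ transfer p54123 , a₆ ∘ transfer p54312
  where
  transfer : ∀ {m} (π : Vec ℕ m) → Contains v π → Contains w π
  transfer = contains-transfer {v = v} {w = w} s s↑ s-order

remove-0F-val : ∀ {N} (u : Permutation′ (suc N)) → u ⟨$⟩ʳ 0F ≡ 0F →
  ∀ j → val u (F.suc j) ≡ suc (val (remove 0F u) j)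
remove-0F-val u u0≡0 j = cong toℕ (trans (punchIn-permute u 0F j) (cong (λ x → F.punchIn x (remove 0F u ⟨$⟩ʳ j)) u0≡0))

restrict : ∀ {N} m (u : Permutation′ N) → (∀ i → toℕ i < m → val u i ≡ toℕ i) →
  Σ (Permutation′ (N ∸ m)) λ v → ∀ i j → toℕ i ≡ toℕ j + m → val u i ≡ val v j + m
restrict zero u _ = u , λ i j i≡j → trans (cong (val u) (FP.toℕ-injective (trans i≡j (+-identityʳ _))))
                                          (sym (+-identityʳ _))
restrict {zero}  (suc m) u _   = u , λ ()
restrict {suc N} (suc m) u fix = proj₁ restricted , rel
  where
  val-suc : ∀ j → val u (F.suc j) ≡ suc (val (remove 0F u) j)
  val-suc = remove-0F-val u (FP.toℕ-injective (fix 0F z<s))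
  restricted : Σ (Permutation′ (N ∸ m)) λ v → ∀ i j → toℕ i ≡ toℕ j + m → val (remove 0F u) i ≡ val v j + m
  restricted = restrict m (remove 0F u) λ i i<m → suc-injective (trans (sym (val-suc i)) (fix (F.suc i) (s<s i<m)))
  rel : ∀ i j → toℕ i ≡ toℕ j + suc m → val u i ≡ val (proj₁ restricted) j + suc m
  rel F.zero    j 0≡ = ⊥-elim (0≢1+n (trans 0≡ (+-suc (toℕ j) m)))
  rel (F.suc i) j i≡ = begin
    val u (F.suc i)                         ≡⟨ val-suc i ⟩
    suc (val (remove 0F u) i)               ≡⟨ cong suc (proj₂ restricted i j (suc-injective (trans i≡ (+-suc (toℕ j) m)))) ⟩
    suc (val (proj₁ restricted) j + m)      ≡⟨ +-suc (val (proj₁ restricted) j) m ⟨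
    val (proj₁ restricted) j + suc m        ∎
    where open ≡-Reasoning

involution : ∀ {N} (g : ℕ → ℕ) → (∀ {x} → x < N → g x < N) → (∀ x → g (g x) ≡ x) → Permutation′ N
involution {N} g g-< g-g = permutation gᶠ gᶠ gᶠ-gᶠ gᶠ-gᶠ
  where
  gᶠ : Fin N → Fin N
  gᶠ y = fromℕ< (g-< (FP.toℕ<n y))
  gᶠ-gᶠ : ∀ y → gᶠ (gᶠ y) ≡ y
  gᶠ-gᶠ y = FP.toℕ-injective (trans (FP.toℕ-fromℕ< _) (trans (cong g (FP.toℕ-fromℕ< _)) (g-g (toℕ y))))

involution-val : ∀ {N} (g : ℕ → ℕ) (g-< : ∀ {x} → x < N → g x < N) (g-g : ∀ x → g (g x) ≡ x) y →
  toℕ (involution g g-< g-g ⟨$⟩ʳ y) ≡ g (toℕ y)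
involution-val g g-< g-g y = FP.toℕ-fromℕ< _

<∸⇒+< : ∀ {j m N} → j < N ∸ m → j + m < N
<∸⇒+< {j} {m} {N} j<N∸m = m≤o∸n⇒m+n≤o (suc j) m≤N j<N∸m
  where
  m≤N : m ≤ N
  m≤N = <⇒≤ (m∸n≢0⇒n<m (λ N∸m≡0 → n≮0 (subst (j <_) N∸m≡0 j<N∸m)))

shift : ∀ {N} m → Fin (N ∸ m) → Fin N
shift m j = fromℕ< (<∸⇒+< {m = m} (FP.toℕ<n j))

toℕ-shift : ∀ {N} m (j : Fin (N ∸ m)) → toℕ (shift m j) ≡ toℕ j + m
toℕ-shift m j = FP.toℕ-fromℕ< _

shift-mono : ∀ {N} m {i j : Fin (N ∸ m)} → i F.< j → shift m i F.< shift m j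
shift-mono m {i} {j} i<j = subst₂ _<_ (sym (toℕ-shift m i)) (sym (toℕ-shift m j)) (+-monoˡ-< m i<j)

relabel-restrict : ∀ {N} (w : Permutation′ N) (g : ℕ → ℕ) (G : Permutation′ N) m →
  (∀ y → toℕ (G ⟨$⟩ʳ y) ≡ g (toℕ y)) →
  (∀ i → toℕ i < m → g (val w i) ≡ toℕ i) →
  (∀ i j → m ≤ toℕ i → m ≤ toℕ j → val w i < val w j → g (val w i) < g (val w j)) →
  AvoidsSix w → Σ (Permutation′ (N ∸ m)) λ v → RestrictsTo m (λ i → g (val w i)) v × AvoidsSix v
relabel-restrict w g G m G-val fixes mono avoids
  with restrict m (w ∘ₚ G) (λ i i<m → trans (G-val (w ⟨$⟩ʳ i)) (fixes i i<m))
... | v , v-rel = v , (fixes , rel) , avoidsSix-transfer {v = v} {w} (shift m) (shift-mono m) order avoids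
  where
  rel : ∀ i j → toℕ i ≡ toℕ j + m → g (val w i) ≡ val v j + m
  rel i j i≡ = trans (sym (G-val (w ⟨$⟩ʳ i))) (v-rel i j i≡)
  v-val : ∀ j → val v j + m ≡ g (val w (shift m j))
  v-val j = sym (rel (shift m j) j (toℕ-shift m j))
  m≤shift : ∀ j → m ≤ toℕ (shift m j)
  m≤shift j = subst (m ≤_) (sym (toℕ-shift m j)) (m≤n+m m (toℕ j))
  g-mono : ∀ i j → val w (shift m i) < val w (shift m j) → val v i < val v j
  g-mono i j lt = +-cancelʳ-< m (val v i) (val v j)
    (subst₂ _<_ (sym (v-val i)) (sym (v-val j)) (mono _ _ (m≤shift i) (m≤shift j) lt))
  g-reflect : ∀ i j → val v i < val v j → val w (shift m i) < val w (shift m j)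
  g-reflect i j lt with <-cmp (val w (shift m i)) (val w (shift m j))
  ... | tri< w< _ _ = w<
  ... | tri≈ _ w≡ _ =
    ⊥-elim (<-irrefl (+-cancelʳ-≡ m (val v i) (val v j) (trans (v-val i) (trans (cong g w≡) (sym (v-val j))))) lt)
  ... | tri> _ _ w> = ⊥-elim (<-asym lt (g-mono j i w>))
  order : ∀ i j → (val v i < val v j) ⇔ (val w (shift m i) < val w (shift m j))
  order i j = mk⇔ (g-reflect i j) (g-mono i j)

w₀-≤ : ∀ {t x} → x ≤ t → w₀ t x ≡ t ∸ x
w₀-≤ {t} {x} x≤t rewrite to T-≡ (≤⇒≤ᵇ x≤t) = refl

w₀-> : ∀ {t x} → t < x → w₀ t x ≡ x
w₀-> {t} {x} t<x rewrite ¬T⇒≡false (<⇒≱ t<x ∘ ≤ᵇ⇒≤ x t) = refl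

w₀-∸ : ∀ {t x} → x ≤ t → w₀ t (t ∸ x) ≡ x
w₀-∸ {t} {x} x≤t = trans (w₀-≤ (m∸n≤m t x)) (m∸[m∸n]≡n x≤t)

w₀-involutive : ∀ t x → w₀ t (w₀ t x) ≡ x
w₀-involutive t x with x ≤? t
... | yes x≤t = trans (cong (w₀ t) (w₀-≤ x≤t)) (w₀-∸ x≤t)
... | no  x≰t = trans (cong (w₀ t) (w₀-> (≰⇒> x≰t))) (w₀-> (≰⇒> x≰t))

w₀-< : ∀ {t x N} → t < N → x < N → w₀ t x < N
w₀-< {t} {x} t<N x<N with x ≤? t
... | yes x≤t = subst (_< _) (sym (w₀-≤ x≤t)) (≤-<-trans (m∸n≤m t x) t<N)
... | no  x≰t = subst (_< _) (sym (w₀-> (≰⇒> x≰t))) x<N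

sₜ-pred : ∀ t → sₜ t (t ∸ 1) ≡ t
sₜ-pred t rewrite to T-≡ (≡⇒≡ᵇ (t ∸ 1) (t ∸ 1) refl) = refl

sₜ-self : ∀ t → sₜ t t ≡ t ∸ 1
sₜ-self zero    = refl
sₜ-self (suc t) rewrite ¬T⇒≡false (1+n≢n ∘ ≡ᵇ⇒≡ (suc t) t) | to T-≡ (≡⇒≡ᵇ t t refl) = refl

sₜ-other : ∀ {t x} → x ≢ t ∸ 1 → x ≢ t → sₜ t x ≡ x
sₜ-other {t} {x} x≢t-1 x≢t
  rewrite ¬T⇒≡false (x≢t-1 ∘ ≡ᵇ⇒≡ x (t ∸ 1)) | ¬T⇒≡false (x≢t ∘ ≡ᵇ⇒≡ x t) = refl

sₜ-involutive : ∀ t x → sₜ t (sₜ t x) ≡ x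
sₜ-involutive t x with x ≟ t ∸ 1 | x ≟ t
... | yes refl | _        = trans (cong (sₜ t) (sₜ-pred t)) (sₜ-self t)
... | no  _    | yes refl = trans (cong (sₜ t) (sₜ-self t)) (sₜ-pred t)
... | no  x≢t-1 | no x≢t  = trans (cong (sₜ t) (sₜ-other x≢t-1 x≢t)) (sₜ-other x≢t-1 x≢t)

sₜ-< : ∀ {t x N} → t < N → x < N → sₜ t x < N
sₜ-< {t} {x} t<N x<N with x ≟ t ∸ 1 | x ≟ t
... | yes refl | _        = subst (_< _) (sym (sₜ-pred t)) t<N
... | no  _    | yes refl = subst (_< _) (sym (sₜ-self t)) (≤-<-trans (m∸n≤m t 1) t<N)
... | no  x≢t-1 | no x≢t  = subst (_< _) (sym (sₜ-other x≢t-1 x≢t)) x<N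

mono-on-split : ∀ {g : ℕ → ℕ} {s t} → s ≤ t → (∀ {x} → t < x → g x ≡ x) → (∀ {x} → x < s → g x ≤ t) →
  (∀ {x y} → x < y → y < s → g x < g y) →
  ∀ {x y} → x < y → x < s ⊎ t < x → y < s ⊎ t < y → g x < g y
mono-on-split s≤t large small-≤ small-mono x<y (inj₁ x<s) (inj₁ y<s) = small-mono x<y y<s
mono-on-split s≤t large small-≤ small-mono x<y (inj₁ x<s) (inj₂ t<y) =
  ≤-<-trans (small-≤ x<s) (subst (_ <_) (sym (large t<y)) t<y)
mono-on-split s≤t large small-≤ small-mono x<y (inj₂ t<x) (inj₁ y<s) =
  ⊥-elim (<-asym (<-trans t<x x<y) (<-≤-trans y<s s≤t))
mono-on-split s≤t large small-≤ small-mono x<y (inj₂ t<x) (inj₂ t<y) =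
  subst₂ _<_ (sym (large t<x)) (sym (large t<y)) x<y

w₀-mono-split : ∀ {s t} → s ≤ 1 → s ≤ t →
  ∀ {x y} → x < y → x < s ⊎ t < x → y < s ⊎ t < y → w₀ t x < w₀ t y
w₀-mono-split {s} {t} s≤1 s≤t = mono-on-split s≤t w₀-> small-≤ small-mono
  where
  small-≤ : ∀ {x} → x < s → w₀ t x ≤ t
  small-≤ {x} x<s = subst (_≤ t) (sym (w₀-≤ (≤-trans (<⇒≤ x<s) s≤t))) (m∸n≤m t x)
  small-mono : ∀ {x y} → x < y → y < s → w₀ t x < w₀ t y
  small-mono x<y y<s = ⊥-elim (<⇒≱ (<-≤-trans y<s s≤1) (≤-trans (s≤s z≤n) x<y))

sₜw₀-0 : ∀ t → sₜ t (w₀ t 0) ≡ t ∸ 1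
sₜw₀-0 t = trans (cong (sₜ t) (w₀-≤ {t} z≤n)) (sₜ-self t)

sₜw₀-1 : ∀ {t} → 1 ≤ t → sₜ t (w₀ t 1) ≡ t
sₜw₀-1 {t} 1≤t = trans (cong (sₜ t) (w₀-≤ 1≤t)) (sₜ-pred t)

sₜw₀-> : ∀ {t x} → t < x → sₜ t (w₀ t x) ≡ x
sₜw₀-> {t} {x} t<x = trans (cong (sₜ t) (w₀-> t<x))
  (sₜ-other (λ x≡t-1 → <⇒≱ t<x (subst (_≤ t) (sym x≡t-1) (m∸n≤m t 1))) (λ x≡t → <-irrefl (sym x≡t) t<x))

sₜw₀-mono-split : ∀ {t} → 2 ≤ t →
  ∀ {x y} → x < y → x < 2 ⊎ t < x → y < 2 ⊎ t < y → sₜ t (w₀ t x) < sₜ t (w₀ t y)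
sₜw₀-mono-split {t} 2≤t = mono-on-split {g = λ x → sₜ t (w₀ t x)} 2≤t sₜw₀-> small-≤ small-mono
  where
  1≤t : 1 ≤ t
  1≤t = ≤-trans (s≤s z≤n) 2≤t
  small-≤ : ∀ {x} → x < 2 → sₜ t (w₀ t x) ≤ t
  small-≤ {0}  _ = subst (_≤ t) (sym (sₜw₀-0 t)) (m∸n≤m t 1)
  small-≤ {1}  _ = ≤-reflexive (sₜw₀-1 1≤t)
  small-≤ {suc (suc _)} (s≤s (s≤s ()))
  small-mono : ∀ {x y} → x < y → y < 2 → sₜ t (w₀ t x) < sₜ t (w₀ t y)
  small-mono {0} {1} _ _ = subst₂ _<_ (sym (sₜw₀-0 t)) (sym (sₜw₀-1 1≤t)) (∸-monoʳ-< (s≤s z≤n) 1≤t)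
  small-mono {suc _} {1} (s≤s ()) _
  small-mono {y = suc (suc _)} _ (s≤s (s≤s ()))

sₜw₀-∸ : ∀ {t i} → 2 ≤ t → i ≤ t ∸ 2 → sₜ t (w₀ t (t ∸ i)) ≡ i
sₜw₀-∸ {t} {i} 2≤t i≤t-2 =
  trans (cong (sₜ t) (w₀-∸ i≤t)) (sₜ-other (<⇒≢ i<t-1) (<⇒≢ (<-≤-trans i<t-1 (m∸n≤m t 1))))
  where
  i<t-1 : i < t ∸ 1
  i<t-1 = ≤-<-trans i≤t-2 (∸-monoʳ-< (n<1+n 1) 2≤t)
  i≤t : i ≤ t
  i≤t = ≤-trans i≤t-2 (m∸n≤m t 2)

-- The set C

module _ {k} (w : Permutation′ (suc k)) where

  pos₀ : Fin (suc k)
  pos₀ = w ⟨$⟩ˡ 0F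

  val-pos₀ : val w pos₀ ≡ 0
  val-pos₀ = cong toℕ (inverseʳ w)

  pos₀-unique : ∀ {x} → val w x ≡ 0 → x ≡ pos₀
  pos₀-unique e = val-injective w (trans e (sym val-pos₀))

  position : ∀ z → z < suc k → Fin (suc k)
  position z z<N = w ⟨$⟩ˡ fromℕ< z<N

  val-position : ∀ z z<N → val w (position z z<N) ≡ z
  val-position z z<N = trans (cong toℕ (inverseʳ w)) (FP.toℕ-fromℕ< z<N)

  inC⇔ : ∀ x → T (inCᵇ w x) ⇔ (toℕ x ≤ posOne w × val w x ≤ wOne w)
  inC⇔ x = ⇔-trans T-∧ (T-≤ᵇ ×-⇔ T-≤ᵇ)

  inR⇔ : ∀ x → T (inRᵇ w x) ⇔ (0 < toℕ x × toℕ x < posOne w × wOne w < val w x)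
  inR⇔ x = ⇔-trans T-∧ (T-<ᵇ ×-⇔ ⇔-trans T-∧ (T-<ᵇ ×-⇔ T-<ᵇ))

  inL⇔ : ∀ x → T (inLᵇ w x) ⇔ (posOne w < toℕ x × 0 < val w x × val w x < wOne w)
  inL⇔ x = ⇔-trans T-∧ (T-<ᵇ ×-⇔ ⇔-trans T-∧ (T-<ᵇ ×-⇔ T-<ᵇ))

  C-decreasing : Avoids w p4231 → ∀ {x y} → T (inCᵇ w x) → T (inCᵇ w y) → x F.< y → val w y < val w x
  C-decreasing avoids {x} {y} x∈C y∈C x<y with <-cmp (val w y) (val w x)
  ... | tri< vy<vx _ _ = vy<vx
  ... | tri≈ _ vy≡vx _ = ⊥-elim (<-irrefl (cong toℕ (sym (val-injective w vy≡vx))) x<y)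
  ... | tri> _ _ vx<vy = ⊥-elim (avoids (contains-4231 w 0<x x<y y<p₀ 0<vx vx<vy vy<a))
    where
    y≤p : toℕ y ≤ posOne w
    y≤p = proj₁ (to (inC⇔ y) y∈C)
    vy≤a : val w y ≤ wOne w
    vy≤a = proj₂ (to (inC⇔ y) y∈C)
    0<x : F._<_ {suc k} 0F x
    0<x = n≢0⇒n>0 λ x≡0 → <⇒≱ vx<vy (subst (λ z → val w y ≤ val w z) (sym (FP.toℕ-injective x≡0)) vy≤a)
    y<p₀ : y F.< pos₀
    y<p₀ = ≤∧≢⇒< y≤p λ y≡p → n≮0 (subst (val w x <_) (trans (cong (val w) (FP.toℕ-injective y≡p)) val-pos₀) vx<vy)
    0<vx : val w pos₀ < val w x
    0<vx = subst (_< val w x) (sym val-pos₀)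
      (n≢0⇒n>0 λ vx≡0 → <⇒≱ x<y (subst (toℕ y ≤_) (cong toℕ (sym (pos₀-unique vx≡0))) y≤p))
    vy<a : val w y < val w 0F
    vy<a = ≤∧≢⇒< vy≤a λ vy≡a → n≮0 (subst (toℕ x <_) (cong toℕ (val-injective w vy≡a)) x<y)

  C-order-reflects : Avoids w p4231 → ∀ {x y} → T (inCᵇ w x) → T (inCᵇ w y) → val w y < val w x → x F.< y
  C-order-reflects avoids {x} {y} x∈C y∈C vy<vx with <-cmp (toℕ x) (toℕ y)
  ... | tri< x<y _ _ = x<y
  ... | tri≈ _ x≡y _ = ⊥-elim (<-irrefl (cong (val w) (FP.toℕ-injective (sym x≡y))) vy<vx)
  ... | tri> _ _ y<x = ⊥-elim (<-asym vy<vx (C-decreasing avoids y∈C x∈C y<x))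

  R⇒noL : Avoids w p3412 → ∀ {r} → T (inRᵇ w r) → ∀ y → ¬ T (inLᵇ w y)
  R⇒noL avoids {r} r∈R y y∈L =
    let 0<r , r<p , a<vr = to (inR⇔ r) r∈R
        p<y , 0<vy , vy<a = to (inL⇔ y) y∈L
    in avoids (contains-3412 w 0<r r<p p<y (subst (_< val w y) (sym val-pos₀) 0<vy) vy<a a<vr)

module WithoutL {k} (w : Permutation′ (suc k)) (avoids : Avoids w p4231) (noL : ∀ y → ¬ T (inLᵇ w y)) where

  private
    a : ℕ
    a = wOne w
    a<N : a < suc k
    a<N = FP.toℕ<n (w ⟨$⟩ʳ 0F)

  inC⇔val≤ : ∀ x → T (inCᵇ w x) ⇔ val w x ≤ a
  inC⇔val≤ x = mk⇔ (proj₂ ∘ to (inC⇔ w x)) small⇒C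
    where
    small⇒C : val w x ≤ a → T (inCᵇ w x)
    small⇒C vx≤a with toℕ x ≤? posOne w
    ... | yes x≤p = from (inC⇔ w x) (x≤p , vx≤a)
    ... | no  x≰p = ⊥-elim (noL x (from (inL⇔ w x) (≰⇒> x≰p , 0<vx , vx<a)))
      where
      0<vx : 0 < val w x
      0<vx = n≢0⇒n>0 λ vx≡0 → x≰p (≤-reflexive (cong toℕ (pos₀-unique w vx≡0)))
      vx<a : val w x < a
      vx<a = ≤∧≢⇒< vx≤a λ vx≡a → x≰p (subst (_≤ posOne w) (cong toℕ (sym (val-injective w vx≡a))) z≤n)

  t⁺≡wOne : t⁺ w ≡ a
  t⁺≡wOne = cong (_∸ 1) (count-val-interval w (inCᵇ w) z≤n a<N λ x →
    ⇔-trans (inC⇔val≤ x) (mk⇔ (λ vx≤a → z≤n , s≤s vx≤a) (s≤s⁻¹ ∘ proj₂)))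

  C-rank : ∀ {x} → T (inCᵇ w x) → count (λ y → (toℕ y <ᵇ toℕ x) ∧ inCᵇ w y) ≡ a ∸ val w x
  C-rank {x} x∈C = count-val-interval w _ (s≤s (to (inC⇔val≤ x) x∈C)) a<N λ y → mk⇔
    (λ t → let y<x , y∈C = to T-∧ t in C-decreasing w avoids y∈C x∈C (to T-<ᵇ y<x) , s≤s (to (inC⇔val≤ y) y∈C))
    (λ (vx<vy , vy≤a) → let y∈C = from (inC⇔val≤ y) (s≤s⁻¹ vy≤a) in
       from T-∧ (from T-<ᵇ (C-order-reflects w avoids y∈C x∈C vx<vy) , y∈C))

  Cs-nth : ∀ {x} → T (inCᵇ w x) → nth (Cs w) (a ∸ val w x) ≡ just x
  Cs-nth {x} x∈C = subst (λ r → nth (Cs w) r ≡ just x) (C-rank x∈C) (nth-filterᵇ-allFin (inCᵇ w) x x∈C)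

  C-prefix-position : ∀ {x} → T (inCᵇ w x) → (∀ y → y F.< x → T (inCᵇ w y)) → toℕ x ≡ a ∸ val w x
  C-prefix-position {x} x∈C prefix = trans (sym (count-prefix (inCᵇ w) x prefix)) (C-rank x∈C)

  run-head : ∀ {c} → T (inCᵇ w c) → (∀ y → y F.< c → T (inCᵇ w y)) →
    ∀ i → toℕ i ≤ toℕ c → val w i ≡ a ∸ toℕ i
  run-head {c} c∈C prefix i i≤c = begin
    val w i                ≡⟨ m∸[m∸n]≡n (to (inC⇔val≤ i) i∈C) ⟨
    a ∸ (a ∸ val w i)      ≡⟨ cong (a ∸_) (C-prefix-position i∈C (λ y y<i → prefix y (<-≤-trans y<i i≤c))) ⟨
    a ∸ toℕ i              ∎
    where
    open ≡-Reasoning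
    i∈C : T (inCᵇ w i)
    i∈C with m≤n⇒m<n∨m≡n i≤c
    ... | inj₁ i<c = prefix i i<c
    ... | inj₂ i≡c = subst (T ∘ inCᵇ w) (sym (FP.toℕ-injective i≡c)) c∈C

  run-tail : ∀ {c} → T (inCᵇ w c) → ∀ i → c F.< i → val w i < val w c ⊎ a < val w i
  run-tail c∈C i c<i with val w i ≤? a
  ... | yes vi≤a = inj₁ (C-decreasing w avoids c∈C (from (inC⇔val≤ i) vi≤a) c<i)
  ... | no  vi≰a = inj₂ (≰⇒> vi≰a)

  relabel-after-run : ∀ {c} → T (inCᵇ w c) → (∀ y → y F.< c → T (inCᵇ w y)) →
    (g : ℕ → ℕ) (G : Permutation′ (suc k)) → (∀ y → toℕ (G ⟨$⟩ʳ y) ≡ g (toℕ y)) →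
    (∀ {i} → i ≤ toℕ c → g (a ∸ i) ≡ i) →
    (∀ {x y} → x < y → x < val w c ⊎ a < x → y < val w c ⊎ a < y → g x < g y) →
    AvoidsSix w → ∀ m → m ≡ suc (toℕ c) →
    Σ (Permutation′ (suc k ∸ m)) λ v → RestrictsTo m (λ i → g (val w i)) v × AvoidsSix v
  relabel-after-run {c} c∈C prefix g G G-val g-fix g-mono avoidsSix m refl =
    relabel-restrict w g G m G-val fixes mono avoidsSix
    where
    fixes : ∀ i → toℕ i < m → g (val w i) ≡ toℕ i
    fixes i i<m = trans (cong g (run-head c∈C prefix i (s≤s⁻¹ i<m))) (g-fix (s≤s⁻¹ i<m))
    mono : ∀ i j → m ≤ toℕ i → m ≤ toℕ j → val w i < val w j → g (val w i) < g (val w j)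
    mono i j m≤i m≤j = λ vi<vj → g-mono vi<vj (run-tail c∈C i m≤i) (run-tail c∈C j m≤j)

inR₁⇔ : ∀ {k} (u : Permutation′ (suc k)) {b c y : Fin (suc k)} →
  nth (Cs u) (t⁺ u ∸ 2) ≡ just b → nth (Cs u) (t⁺ u ∸ 1) ≡ just c →
  T (inR₁ᵇ u y) ⇔ (T (inRᵇ u y) × 2 ≤ t⁺ u × b F.< y × y F.< c)
inR₁⇔ u nth-b nth-c rewrite nth-b | nth-c =
  ⇔-trans T-∧ (⇔-refl ×-⇔ ⇔-trans T-∧ (T-≤ᵇ ×-⇔ ⇔-trans T-∧ (T-<ᵇ ×-⇔ T-<ᵇ)))

¬TypeR₁-of-C-prefix : ∀ {k} (u : Permutation′ (suc k)) (c : Fin (suc k)) → toℕ c ≡ t⁺ u ∸ 1 →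
  (∀ y → toℕ y ≤ toℕ c → T (inCᵇ u y)) → ¬ TypeR₁ u
¬TypeR₁-of-C-prefix {k} u c c≡t-1 prefix (y , y∈R₁) = <⇒≱ b<y (<⇒≤pred y<c)
  where
  -- c_{t-2} and c_{t-1} are the adjacent positions c − 1 and c.
  b : Fin (suc k)
  b = fromℕ< (≤-<-trans (m∸n≤m (toℕ c) 1) (FP.toℕ<n c))
  toℕ-b : toℕ b ≡ toℕ c ∸ 1
  toℕ-b = FP.toℕ-fromℕ< _
  nth-b : nth (Cs u) (t⁺ u ∸ 2) ≡ just b
  nth-b = subst (λ r → nth (Cs u) r ≡ just b) (trans toℕ-b (trans (cong (_∸ 1) c≡t-1) (∸-+-assoc (t⁺ u) 1 1)))
    (nth-filterᵇ-allFin-prefix (inCᵇ u) b λ z z≤b →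
      prefix z (≤-trans z≤b (subst (_≤ toℕ c) (sym toℕ-b) (m∸n≤m (toℕ c) 1))))
  nth-c : nth (Cs u) (t⁺ u ∸ 1) ≡ just c
  nth-c = subst (λ r → nth (Cs u) r ≡ just c) c≡t-1 (nth-filterᵇ-allFin-prefix (inCᵇ u) c prefix)
  b<y : toℕ c ∸ 1 < toℕ y
  b<y = subst (_< toℕ y) toℕ-b (proj₁ (proj₂ (proj₂ (to (inR₁⇔ u nth-b nth-c) y∈R₁))))
  y<c : toℕ y < toℕ c
  y<c = proj₂ (proj₂ (proj₂ (to (inR₁⇔ u nth-b nth-c) y∈R₁)))

inC-flip : ∀ {k} (u : Permutation′ (suc k)) y → T (inCᵇ (flip u) y) ⇔ T (inCᵇ u (u ⟨$⟩ˡ y))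
inC-flip u y = ⇔-trans (inC⇔ (flip u) y) (⇔-trans swap-⇔ (⇔-sym (inC⇔ u (u ⟨$⟩ˡ y))))
  where
  val-u⁻¹ : val u (u ⟨$⟩ˡ y) ≡ toℕ y
  val-u⁻¹ = cong toℕ (inverseʳ u)
  swap-⇔ : (toℕ y ≤ wOne u × toℕ (u ⟨$⟩ˡ y) ≤ posOne u) ⇔
           (toℕ (u ⟨$⟩ˡ y) ≤ posOne u × val u (u ⟨$⟩ˡ y) ≤ wOne u)
  swap-⇔ = mk⇔ (λ (y≤a , x≤p) → x≤p , subst (_≤ wOne u) (sym val-u⁻¹) y≤a)
               (λ (x≤p , vx≤a) → subst (_≤ wOne u) val-u⁻¹ vx≤a , x≤p)

t⁺-flip : ∀ {k} (u : Permutation′ (suc k)) → t⁺ (flip u) ≡ t⁺ u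
t⁺-flip u = cong (_∸ 1) (trans (count-cong (inC-flip u)) (count-permute (inCᵇ u) (flip u)))

-- Under these hypotheses C(u) = {0, …, κ} ∪ {u⁻¹(0)}; this is the shape of w′ in type r₁.
module InitialBlock {M} (u : Permutation′ (suc M)) {κ : Fin (suc M)} (val-κ : val u κ ≡ 1) (κ<p : toℕ κ < posOne u)
  (head-small : ∀ j → toℕ j ≤ toℕ κ → val u j ≤ wOne u)
  (middle-large : ∀ j → κ F.< j → toℕ j < posOne u → wOne u < val u j) where

  head-in-C : ∀ j → toℕ j ≤ toℕ κ → T (inCᵇ u j)
  head-in-C j j≤κ = from (inC⇔ u j) (≤-trans j≤κ (<⇒≤ κ<p) , head-small j j≤κ)

  pos₀-in-C : T (inCᵇ u (pos₀ u))
  pos₀-in-C = from (inC⇔ u (pos₀ u)) (≤-refl , subst (_≤ wOne u) (sym (val-pos₀ u)) z≤n)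

  t⁺≡block : t⁺ u ≡ suc (toℕ κ)
  t⁺≡block = trans (cong (_∸ 1) count-C) (m+n∸n≡m (suc (toℕ κ)) 1)
    where
    open ≡-Reasoning
    atHead : Fin (suc M) → Bool
    atHead j = toℕ j ≤ᵇ toℕ κ
    pred≤ : (x : Fin (suc M)) → toℕ x ≤ M
    pred≤ x = s≤s⁻¹ (FP.toℕ<n x)
    head⇔ : ∀ j → T (inCᵇ u j ∧ atHead j) ⇔ (0 ≤ toℕ j × toℕ j < suc (toℕ κ))
    head⇔ j = mk⇔ (λ t → z≤n , s≤s (to T-≤ᵇ (proj₂ (to T-∧ t))))
                  (λ (_ , j<κ+1) → from T-∧ (head-in-C j (s≤s⁻¹ j<κ+1) , from T-≤ᵇ (s≤s⁻¹ j<κ+1)))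
    tail⇔ : ∀ j → T (inCᵇ u j ∧ not (atHead j)) ⇔ (posOne u ≤ toℕ j × toℕ j < suc (posOne u))
    tail⇔ j = mk⇔
      (λ t → let j∈C , j≰κ = to T-∧ t
                 j≤p , vj≤a = to (inC⇔ u j) j∈C
                 κ<j = ≰⇒> (to T-not j≰κ ∘ from T-≤ᵇ) in
             ≮⇒≥ (λ j<p → <⇒≱ (middle-large j κ<j j<p) vj≤a) , s≤s j≤p)
      (λ (p≤j , j<p+1) → from T-∧
        ( subst (T ∘ inCᵇ u) (sym (FP.toℕ-injective (≤-antisym (s≤s⁻¹ j<p+1) p≤j))) pos₀-in-C
        , from T-not (λ j≤κ → <⇒≱ κ<p (≤-trans p≤j (to T-≤ᵇ j≤κ)))))
    count-C : count (inCᵇ u) ≡ suc (toℕ κ) + 1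
    count-C = begin
      count (inCᵇ u)                                        ≡⟨ count-split (inCᵇ u) atHead ⟩
      count (λ j → inCᵇ u j ∧ atHead j) + count (λ j → inCᵇ u j ∧ not (atHead j))
        ≡⟨ cong₂ _+_ (count-interval _ z≤n (s≤s (≤-trans (<⇒≤ κ<p) (pred≤ (pos₀ u)))) head⇔)
                     (count-interval _ (n≤1+n (posOne u)) (FP.toℕ<n (pos₀ u)) tail⇔) ⟩
      suc (toℕ κ) + (suc (posOne u) ∸ posOne u)
        ≡⟨ cong (suc (toℕ κ) +_) (trans (cong (_∸ posOne u) (+-comm 1 (posOne u))) (m+n∸m≡n (posOne u) 1)) ⟩
      suc (toℕ κ) + 1                                                       ∎

  ¬TypeR₁-block : ¬ TypeR₁ u
  ¬TypeR₁-block = ¬TypeR₁-of-C-prefix u κ (cong (_∸ 1) (sym t⁺≡block)) head-in-C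

  ¬TypeL₁-block : toℕ κ ≡ 1 → ¬ TypeL₁ u
  ¬TypeL₁-block κ≡1 = ¬TypeR₁-of-C-prefix (flip u) κ κ≡t-1 λ y y≤κ →
    from (inC-flip u y) (small-in-C (u ⟨$⟩ˡ y) (subst (_≤ 1) (sym (cong toℕ (inverseʳ u))) (subst (toℕ y ≤_) κ≡1 y≤κ)))
    where
    κ≡t-1 : toℕ κ ≡ t⁺ (flip u) ∸ 1
    κ≡t-1 = cong (_∸ 1) (sym (trans (t⁺-flip u) t⁺≡block))
    small-in-C : ∀ x → val u x ≤ 1 → T (inCᵇ u x)
    small-in-C x vx≤1 with m≤n⇒m<n∨m≡n vx≤1
    ... | inj₁ vx<1 = subst (T ∘ inCᵇ u) (sym (pos₀-unique u (n<1⇒n≡0 vx<1))) pos₀-in-C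
    ... | inj₂ vx≡1 = subst (T ∘ inCᵇ u) (sym (val-injective u (trans vx≡1 (sym val-κ)))) (head-in-C κ ≤-refl)

inR₁⇒inR : ∀ {k} (u : Permutation′ (suc k)) {y} → T (inR₁ᵇ u y) → T (inRᵇ u y)
inR₁⇒inR u {y} = proj₁ ∘ to (T-∧ {inRᵇ u y})

inR₁⇒2≤t⁺ : ∀ {k} (u : Permutation′ (suc k)) {y} → T (inR₁ᵇ u y) → 2 ≤ t⁺ u
inR₁⇒2≤t⁺ u {y} = to T-≤ᵇ ∘ proj₁ ∘ to (T-∧ {2 ≤ᵇ t⁺ u}) ∘ proj₂ ∘ to (T-∧ {inRᵇ u y})

-- The three types

W₀ : ∀ {N} t → t < N → Permutation′ N
W₀ t t<N = involution (w₀ t) (w₀-< t<N) (w₀-involutive t)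

toℕ-W₀ : ∀ {N} t (t<N : t < N) y → toℕ (W₀ t t<N ⟨$⟩ʳ y) ≡ w₀ t (toℕ y)
toℕ-W₀ t t<N = involution-val (w₀ t) (w₀-< t<N) (w₀-involutive t)

Sₜ : ∀ {N} t → t < N → Permutation′ N
Sₜ t t<N = involution (sₜ t) (sₜ-< t<N) (sₜ-involutive t)

toℕ-Sₜ : ∀ {N} t (t<N : t < N) y → toℕ (Sₜ t t<N ⟨$⟩ʳ y) ≡ sₜ t (toℕ y)
toℕ-Sₜ t t<N = involution-val (sₜ t) (sₜ-< t<N) (sₜ-involutive t)

module TypeNCase {k} (w : Permutation′ (suc k)) (avoids : AvoidsSix w)
  (noR : ∀ y → ¬ T (inRᵇ w y)) (noL : ∀ y → ¬ T (inLᵇ w y)) where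

  open WithoutL w (proj₁ (proj₂ avoids)) noL

  private
    a : ℕ
    a = wOne w
    a<N : a < suc k
    a<N = FP.toℕ<n (w ⟨$⟩ʳ 0F)

  up-to-pos₀-in-C : ∀ y → toℕ y ≤ posOne w → T (inCᵇ w y)
  up-to-pos₀-in-C y y≤p with val w y ≤? a
  ... | yes vy≤a = from (inC⇔ w y) (y≤p , vy≤a)
  ... | no  vy≰a = ⊥-elim (noR y (from (inR⇔ w y) (0<y , y<p , ≰⇒> vy≰a)))
    where
    0<y : 0 < toℕ y
    0<y = n≢0⇒n>0 λ y≡0 → vy≰a (≤-reflexive (cong (val w) (FP.toℕ-injective y≡0)))
    y<p : toℕ y < posOne w
    y<p = ≤∧≢⇒< y≤p λ y≡p →
      vy≰a (subst (_≤ a) (sym (trans (cong (val w) (FP.toℕ-injective y≡p)) (val-pos₀ w))) z≤n)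

  pos₀-prefix : ∀ y → y F.< pos₀ w → T (inCᵇ w y)
  pos₀-prefix y y<p = up-to-pos₀-in-C y (<⇒≤ y<p)

  pos₀-in-C : T (inCᵇ w (pos₀ w))
  pos₀-in-C = up-to-pos₀-in-C (pos₀ w) ≤-refl

  posOne≡wOne : posOne w ≡ a
  posOne≡wOne = trans (C-prefix-position pos₀-in-C pos₀-prefix) (cong (a ∸_) (val-pos₀ w))

  head-val : ∀ i → toℕ i ≤ a → val w i ≡ a ∸ toℕ i
  head-val i i≤a = run-head pos₀-in-C pos₀-prefix i (subst (toℕ i ≤_) (sym posOne≡wOne) i≤a)

  tail-val : ∀ i → a < toℕ i → a < val w i
  tail-val i a<i with run-tail pos₀-in-C i (subst (_< toℕ i) (sym posOne≡wOne) a<i)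
  ... | inj₁ vi<0 = ⊥-elim (n≮0 (subst (val w i <_) (val-pos₀ w) vi<0))
  ... | inj₂ a<vi = a<vi

  w₀-commutes : ∀ i j → toℕ j ≡ w₀ a (toℕ i) → val w j ≡ w₀ a (val w i)
  w₀-commutes i j j≡ with toℕ i ≤? a
  ... | yes i≤a = begin
    val w j              ≡⟨ head-val j j≤a ⟩
    a ∸ toℕ j            ≡⟨ cong (a ∸_) j≡a-i ⟩
    a ∸ (a ∸ toℕ i)      ≡⟨ m∸[m∸n]≡n i≤a ⟩
    toℕ i                ≡⟨ w₀-∸ i≤a ⟨
    w₀ a (a ∸ toℕ i)     ≡⟨ cong (w₀ a) (head-val i i≤a) ⟨
    w₀ a (val w i)       ∎
    where
    open ≡-Reasoning
    j≡a-i : toℕ j ≡ a ∸ toℕ i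
    j≡a-i = trans j≡ (w₀-≤ i≤a)
    j≤a : toℕ j ≤ a
    j≤a = subst (_≤ a) (sym j≡a-i) (m∸n≤m a (toℕ i))
  ... | no  i≰a = trans (cong (val w) (FP.toℕ-injective (trans j≡ (w₀-> (≰⇒> i≰a)))))
                        (sym (w₀-> (tail-val i (≰⇒> i≰a))))

  typeN-part : ∀ t → t ≡ a →
    (∀ (i j : Fin (suc k)) → toℕ j ≡ w₀ t (toℕ i) → toℕ (w ⟨$⟩ʳ j) ≡ w₀ t (toℕ (w ⟨$⟩ʳ i))) ×
    Σ (Permutation′ (suc k ∸ suc t)) (λ v → RestrictsTo (suc t) (λ i → w₀ t (toℕ (w ⟨$⟩ʳ i))) v × AvoidsSix v)
  typeN-part t refl = w₀-commutes ,
    relabel-after-run pos₀-in-C pos₀-prefix (w₀ a) (W₀ a a<N) (toℕ-W₀ a a<N)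
      (λ i≤p → w₀-∸ (subst (_ ≤_) posOne≡wOne i≤p))
      (λ x<y x-side y-side → w₀-mono-split z≤n z≤n x<y (side x-side) (side y-side))
      avoids (suc a) (cong suc (sym posOne≡wOne))
    where
    side : ∀ {x} → x < val w (pos₀ w) ⊎ a < x → x < 0 ⊎ a < x
    side = map₁ (subst (_ <_) (val-pos₀ w))

module TypeRCase {k} (w : Permutation′ (suc k)) (avoids : AvoidsSix w) {r} (r∈R : T (inRᵇ w r)) where

  avoids4231 : Avoids w p4231
  avoids4231 = proj₁ (proj₂ avoids)

  avoids34521 : Avoids w p34521
  avoids34521 = proj₁ (proj₂ (proj₂ avoids))

  avoids45321 : Avoids w p45321
  avoids45321 = proj₁ (proj₂ (proj₂ (proj₂ avoids)))

  open WithoutL w avoids4231 (R⇒noL w (proj₁ avoids) {r} r∈R) public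

  a : ℕ
  a = wOne w

  a<N : a < suc k
  a<N = FP.toℕ<n (w ⟨$⟩ʳ 0F)

  1≤a : 1 ≤ a
  1≤a = n≢0⇒n>0 λ a≡0 →
    n≮0 (subst (toℕ r <_) (cong toℕ (sym (pos₀-unique w a≡0))) (proj₁ (proj₂ (to (inR⇔ w r) r∈R))))

  pos₀-in-C : T (inCᵇ w (pos₀ w))
  pos₀-in-C = from (inC⇔val≤ (pos₀ w)) (subst (_≤ a) (sym (val-pos₀ w)) z≤n)

  -- q₁ and q₂ carry the 0-based values 1 and 2: they are w⁻¹(2) and w⁻¹(3) of the paper,
  -- the last two elements of C.
  q₁ : Fin (suc k)
  q₁ = position w 1 (≤-<-trans 1≤a a<N)

  val-q₁ : val w q₁ ≡ 1
  val-q₁ = val-position w 1 (≤-<-trans 1≤a a<N)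

  q₁-in-C : T (inCᵇ w q₁)
  q₁-in-C = from (inC⇔val≤ q₁) (subst (_≤ a) (sym val-q₁) 1≤a)

  q₁<p₀ : q₁ F.< pos₀ w
  q₁<p₀ = C-order-reflects w avoids4231 q₁-in-C pos₀-in-C (subst₂ _<_ (sym (val-pos₀ w)) (sym val-q₁) z<s)

  nth-q₁ : nth (Cs w) (t⁺ w ∸ 1) ≡ just q₁
  nth-q₁ = subst (λ i → nth (Cs w) i ≡ just q₁) (trans (cong (a ∸_) val-q₁) (cong (_∸ 1) (sym t⁺≡wOne)))
    (Cs-nth q₁-in-C)

  module TwoBelow (2≤a : 2 ≤ a) where

    q₂ : Fin (suc k)
    q₂ = position w 2 (≤-<-trans 2≤a a<N)

    val-q₂ : val w q₂ ≡ 2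
    val-q₂ = val-position w 2 (≤-<-trans 2≤a a<N)

    q₂-in-C : T (inCᵇ w q₂)
    q₂-in-C = from (inC⇔val≤ q₂) (subst (_≤ a) (sym val-q₂) 2≤a)

    q₂<q₁ : q₂ F.< q₁
    q₂<q₁ = C-order-reflects w avoids4231 q₂-in-C q₁-in-C (subst₂ _<_ (sym val-q₁) (sym val-q₂) (s<s z<s))

    nth-q₂ : nth (Cs w) (t⁺ w ∸ 2) ≡ just q₂
    nth-q₂ = subst (λ i → nth (Cs w) i ≡ just q₂) (trans (cong (a ∸_) val-q₂) (cong (_∸ 2) (sym t⁺≡wOne)))
      (Cs-nth q₂-in-C)

    before-q₂-in-C : ∀ y → y F.< q₂ → T (inCᵇ w y)
    before-q₂-in-C y y<q₂ with val w y ≤? a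
    ... | yes vy≤a = from (inC⇔val≤ y) vy≤a
    ... | no  vy≰a = ⊥-elim (avoids45321
          (contains-45321 w 0<y y<q₂ q₂<q₁ q₁<p₀ (subst₂ _<_ (sym (val-pos₀ w)) (sym val-q₁) z<s)
            (subst₂ _<_ (sym val-q₁) (sym val-q₂) (s<s z<s)) vq₂<a (≰⇒> vy≰a)))
      where
      0<y : F._<_ {suc k} 0F y
      0<y = n≢0⇒n>0 λ y≡0 → vy≰a (≤-reflexive (cong (val w) (FP.toℕ-injective y≡0)))
      vq₂<a : val w q₂ < a
      vq₂<a = ≤∧≢⇒< (to (inC⇔val≤ q₂) q₂-in-C) λ vq₂≡a →
        n≮0 (subst (toℕ y <_) (cong toℕ (val-injective w vq₂≡a)) y<q₂)

    between-in-R : ∀ y → q₂ F.< y → y F.< q₁ → T (inRᵇ w y)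
    between-in-R y q₂<y y<q₁ = from (inR⇔ w y) (≤-<-trans z≤n q₂<y , <-trans y<q₁ q₁<p₀ , ≰⇒> vy≰a)
      where
      vy≰a : ¬ val w y ≤ a
      vy≰a vy≤a = <⇒≱ (subst (val w y <_) val-q₂ (C-decreasing w avoids4231 q₂-in-C y∈C q₂<y))
                      (subst (_< val w y) val-q₁ (C-decreasing w avoids4231 y∈C q₁-in-C y<q₁))
        where
        y∈C : T (inCᵇ w y)
        y∈C = from (inC⇔val≤ y) vy≤a

    inR₁⇔between : ∀ y → T (inR₁ᵇ w y) ⇔ (q₂ F.< y × y F.< q₁)
    inR₁⇔between y = ⇔-trans (inR₁⇔ w nth-q₂ nth-q₁) (mk⇔
      (λ (_ , _ , q₂<y , y<q₁) → q₂<y , y<q₁)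
      (λ (q₂<y , y<q₁) → between-in-R y q₂<y y<q₁ , subst (2 ≤_) (sym t⁺≡wOne) 2≤a , q₂<y , y<q₁))

    before-q₁-in-C : ¬ TypeR₁ w → ∀ y → y F.< q₁ → T (inCᵇ w y)
    before-q₁-in-C ¬R₁ y y<q₁ with <-cmp (toℕ y) (toℕ q₂)
    ... | tri< y<q₂ _ _ = before-q₂-in-C y y<q₂
    ... | tri≈ _ y≡q₂ _ = subst (T ∘ inCᵇ w) (sym (FP.toℕ-injective y≡q₂)) q₂-in-C
    ... | tri> _ _ q₂<y = ⊥-elim (¬R₁ (y , from (inR₁⇔between y) (q₂<y , y<q₁)))

    toℕ-q₂ : toℕ q₂ ≡ a ∸ 2
    toℕ-q₂ = trans (C-prefix-position q₂-in-C before-q₂-in-C) (cong (a ∸_) val-q₂)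

  before-q₁-in-C : ¬ TypeR₁ w → ∀ y → y F.< q₁ → T (inCᵇ w y)
  before-q₁-in-C ¬R₁ y y<q₁ with 2 ≤? a
  ... | no 2≰a = ⊥-elim (n≮0 (subst (toℕ y <_) (cong toℕ (val-injective w (trans val-q₁ (sym a≡1)))) y<q₁))
    where
    a≡1 : a ≡ 1
    a≡1 = ≤-antisym (s≤s⁻¹ (≰⇒> 2≰a)) 1≤a
  ... | yes 2≤a = TwoBelow.before-q₁-in-C 2≤a ¬R₁ y y<q₁

  typeR₀-part : ¬ TypeR₁ w → ∀ t → t ≡ a →
    Σ (Permutation′ (suc k ∸ t)) (λ v → RestrictsTo t (λ i → w₀ t (toℕ (w ⟨$⟩ʳ i))) v × AvoidsSix v)
  typeR₀-part ¬R₁ t refl =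
    relabel-after-run q₁-in-C (before-q₁-in-C ¬R₁) (w₀ a) (W₀ a a<N) (toℕ-W₀ a a<N)
      (λ i≤q₁ → w₀-∸ (≤-trans i≤q₁ (subst (_≤ a) (sym toℕ-q₁) (m∸n≤m a 1))))
      (w₀-mono-split (≤-reflexive val-q₁) (subst (_≤ a) (sym val-q₁) 1≤a))
      avoids a (sym (trans (cong suc toℕ-q₁) (sym (+-∸-assoc 1 1≤a))))
    where
    toℕ-q₁ : toℕ q₁ ≡ a ∸ 1
    toℕ-q₁ = trans (C-prefix-position q₁-in-C (before-q₁-in-C ¬R₁)) (cong (a ∸_) val-q₁)

module TypeR₁Case {k} (w : Permutation′ (suc k)) (avoids : AvoidsSix w) {y₀} (y₀∈R₁ : T (inR₁ᵇ w y₀)) where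

  open TypeRCase w avoids {y₀} (inR₁⇒inR w {y₀} y₀∈R₁)

  2≤a : 2 ≤ a
  2≤a = subst (2 ≤_) t⁺≡wOne (inR₁⇒2≤t⁺ w {y₀} y₀∈R₁)

  open TwoBelow 2≤a

  m : ℕ
  m = a ∸ 1

  m≡1+q₂ : m ≡ suc (toℕ q₂)
  m≡1+q₂ = trans (+-∸-assoc 1 2≤a) (cong suc (sym toℕ-q₂))

  g : ℕ → ℕ
  g x = sₜ a (w₀ a x)

  G : Permutation′ (suc k)
  G = W₀ a a<N ∘ₚ Sₜ a a<N

  toℕ-G : ∀ y → toℕ (G ⟨$⟩ʳ y) ≡ g (toℕ y)
  toℕ-G y = trans (toℕ-Sₜ a a<N (W₀ a a<N ⟨$⟩ʳ y)) (cong (sₜ a) (toℕ-W₀ a a<N y))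

  relabelled : Σ (Permutation′ (suc k ∸ m)) λ v → RestrictsTo m (λ i → g (val w i)) v × AvoidsSix v
  relabelled = relabel-after-run q₂-in-C before-q₂-in-C g G toℕ-G
    (λ i≤q₂ → sₜw₀-∸ 2≤a (subst (_ ≤_) toℕ-q₂ i≤q₂))
    (λ x<y x-side y-side → sₜw₀-mono-split 2≤a x<y (side x-side) (side y-side))
    avoids m m≡1+q₂
    where
    side : ∀ {x} → x < val w q₂ ⊎ a < x → x < 2 ⊎ a < x
    side = map₁ (subst (_ <_) val-q₂)

  cardR₁≡ : cardR₁ w ≡ toℕ q₁ ∸ m
  cardR₁≡ = count-interval (inR₁ᵇ w) (subst (_≤ toℕ q₁) (sym m≡1+q₂) q₂<q₁) (<⇒≤ (FP.toℕ<n q₁)) λ y →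
    ⇔-trans (inR₁⇔between y) (mk⇔ (λ (q₂<y , y<q₁) → subst (_≤ toℕ y) (sym m≡1+q₂) q₂<y , y<q₁)
                                  (λ (m≤y , y<q₁) → subst (_≤ toℕ y) m≡1+q₂ m≤y , y<q₁))

  m≤q₁ : m ≤ toℕ q₁
  m≤q₁ = subst (_≤ toℕ q₁) (sym m≡1+q₂) q₂<q₁

  m<q₁ : m < toℕ q₁
  m<q₁ = ≤-<-trans (subst (_≤ toℕ y₀) (sym m≡1+q₂) (proj₁ y₀-between)) (proj₂ y₀-between)
    where
    y₀-between : q₂ F.< y₀ × y₀ F.< q₁
    y₀-between = to (inR₁⇔between y₀) y₀∈R₁

  m≤p₀ : m ≤ posOne w
  m≤p₀ = ≤-trans m≤q₁ (<⇒≤ q₁<p₀)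

  a≡1+m : a ≡ 1 + m
  a≡1+m = +-∸-assoc 1 1≤a

  module Restricted {M} (v : Permutation′ (suc M)) (M-eq : suc M ≡ suc k ∸ m)
    (v-rel : ∀ i j → toℕ i ≡ toℕ j + m → g (val w i) ≡ val v j + m) where

    up : Fin (suc M) → Fin (suc k)
    up j = fromℕ< (<∸⇒+< {m = m} (subst (toℕ j <_) M-eq (FP.toℕ<n j)))

    toℕ-up : ∀ j → toℕ (up j) ≡ toℕ j + m
    toℕ-up j = FP.toℕ-fromℕ< _

    down : (i : Fin (suc k)) → m ≤ toℕ i → Fin (suc M)
    down i m≤i = fromℕ< (subst (toℕ i ∸ m <_) (sym M-eq) (∸-monoˡ-< (FP.toℕ<n i) m≤i))

    toℕ-down : ∀ i m≤i → toℕ (down i m≤i) ≡ toℕ i ∸ m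
    toℕ-down i m≤i = FP.toℕ-fromℕ< _

    val-up : ∀ j → val v j + m ≡ g (val w (up j))
    val-up j = sym (v-rel (up j) j (toℕ-up j))

    val-down : ∀ i m≤i → val v (down i m≤i) + m ≡ g (val w i)
    val-down i m≤i = trans (val-up (down i m≤i)) (cong (g ∘ val w) up-down)
      where
      up-down : up (down i m≤i) ≡ i
      up-down = FP.toℕ-injective (trans (toℕ-up _) (trans (cong (_+ m) (toℕ-down i m≤i)) (m∸n+n≡m m≤i)))

    large-up : ∀ j → a < val w (up j) → val v j + m ≡ val w (up j)
    large-up j a<vw = trans (val-up j) (sₜw₀-> a<vw)

    κ : Fin (suc M)
    κ = down q₁ m≤q₁

    val-κ : val v κ ≡ 1
    val-κ = +-cancelʳ-≡ m (val v κ) 1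
      (trans (val-down q₁ m≤q₁) (trans (cong g val-q₁) (trans (sₜw₀-1 1≤a) a≡1+m)))

    posOne-v : posOne v ≡ posOne w ∸ m
    posOne-v = trans (cong toℕ (sym (pos₀-unique v val-down-pos₀))) (toℕ-down (pos₀ w) m≤p₀)
      where
      val-down-pos₀ : val v (down (pos₀ w) m≤p₀) ≡ 0
      val-down-pos₀ = +-cancelʳ-≡ m _ 0
        (trans (val-down (pos₀ w) m≤p₀) (trans (cong g (val-pos₀ w)) (sₜw₀-0 a)))

    κ<p : toℕ κ < posOne v
    κ<p = subst₂ _<_ (sym (toℕ-down q₁ m≤q₁)) (sym posOne-v) (∸-monoˡ-< q₁<p₀ m≤q₁)

    q₂<up : ∀ j → q₂ F.< up j
    q₂<up j = subst₂ _≤_ m≡1+q₂ (sym (toℕ-up j)) (m≤n+m m (toℕ j))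

    up0<q₁ : up 0F F.< q₁
    up0<q₁ = subst (_< toℕ q₁) (sym (toℕ-up 0F)) m<q₁

    large₀ : a < val w (up 0F)
    large₀ = proj₂ (proj₂ (to (inR⇔ w (up 0F)) (between-in-R (up 0F) (q₂<up 0F) up0<q₁)))

    2≤v0 : 2 ≤ val v 0F
    2≤v0 = +-cancelʳ-< m 1 (val v 0F) (subst₂ _<_ a≡1+m (sym (large-up 0F large₀)) large₀)

    up-mono : ∀ {i j} → i F.< j → up i F.< up j
    up-mono {i} {j} i<j = subst₂ _<_ (sym (toℕ-up i)) (sym (toℕ-up j)) (+-monoˡ-< m i<j)

    toℕ-q₁ : toℕ q₁ ≡ toℕ κ + m
    toℕ-q₁ = sym (trans (cong (_+ m) (toℕ-down q₁ m≤q₁)) (m∸n+n≡m m≤q₁))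

    head-small : ∀ j → toℕ j ≤ toℕ κ → val v j ≤ val v 0F
    head-small 0F        _    = ≤-refl
    head-small (F.suc j) j≤κ = [ inner , at-κ ]′ (m≤n⇒m<n∨m≡n j≤κ)
      where
      at-κ : toℕ (F.suc j) ≡ toℕ κ → val v (F.suc j) ≤ val v 0F
      at-κ j≡κ = subst (_≤ val v 0F) (sym (trans (cong (val v) (FP.toℕ-injective j≡κ)) val-κ)) (<⇒≤ 2≤v0)
      inner : F.suc j F.< κ → val v (F.suc j) ≤ val v 0F
      inner j<κ = ≮⇒≥ λ v0<vj → avoids34521
          (contains-34521 w 0<up0 (up-mono z<s) upj<q₁ q₁<p₀
            (subst₂ _<_ (sym (val-pos₀ w)) (sym val-q₁) z<s) (subst (_< a) (sym val-q₁) 2≤a) large₀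
            (subst₂ _<_ (large-up 0F large₀) (large-up (F.suc j) large-j) (+-monoˡ-< m v0<vj)))
        where
        0<up0 : F._<_ {suc k} 0F (up 0F)
        0<up0 = subst (0 <_) (sym (toℕ-up 0F)) (subst (0 <_) (sym m≡1+q₂) z<s)
        upj<q₁ : up (F.suc j) F.< q₁
        upj<q₁ = subst₂ _<_ (sym (toℕ-up (F.suc j))) (sym toℕ-q₁) (+-monoˡ-< m j<κ)
        large-j : a < val w (up (F.suc j))
        large-j = proj₂ (proj₂ (to (inR⇔ w (up (F.suc j))) (between-in-R (up (F.suc j)) (q₂<up (F.suc j)) upj<q₁)))

    middle-large : ∀ j → κ F.< j → toℕ j < posOne v → val v 0F < val v j
    middle-large (F.suc j) κ<j j<p = ≰⇒> λ vj≤v0 → avoids4231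
      (contains-4231 w up0<q₁ q₁<upj upj<p₀ (subst₂ _<_ (sym (val-pos₀ w)) (sym val-q₁) z<s)
        (subst (_< val w (up (F.suc j))) (sym val-q₁) (<-trans 2≤a large-j))
        (subst₂ _<_ (large-up (F.suc j) large-j) (large-up 0F large₀)
          (+-monoˡ-< m (≤∧≢⇒< vj≤v0 λ e → FP.0≢1+n (sym (val-injective v e))))))
      where
      q₁<upj : q₁ F.< up (F.suc j)
      q₁<upj = subst₂ _<_ (sym toℕ-q₁) (sym (toℕ-up (F.suc j))) (+-monoˡ-< m κ<j)
      upj<p₀ : up (F.suc j) F.< pos₀ w
      upj<p₀ = subst (_< posOne w) (sym (toℕ-up (F.suc j))) (<∸⇒+< (subst (toℕ (F.suc j) <_) posOne-v j<p))
      not-small : val w (up (F.suc j)) < val w q₂ → a < val w (up (F.suc j))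
      not-small vw<2 = ⊥-elim ([ is-0 , is-1 ]′ (m≤n⇒m<n∨m≡n (s≤s⁻¹ (subst (val w (up (F.suc j)) <_) val-q₂ vw<2))))
        where
        is-0 : val w (up (F.suc j)) < 1 → ⊥
        is-0 vw<1 = <-irrefl (cong toℕ (pos₀-unique w (n<1⇒n≡0 vw<1))) upj<p₀
        is-1 : val w (up (F.suc j)) ≡ 1 → ⊥
        is-1 vw≡1 = <-irrefl (cong toℕ (sym (val-injective w (trans vw≡1 (sym val-q₁))))) q₁<upj
      large-j : a < val w (up (F.suc j))
      large-j = [ not-small , (λ a<vw → a<vw) ]′ (run-tail q₂-in-C (up (F.suc j)) (q₂<up (F.suc j)))

    open InitialBlock v val-κ κ<p head-small middle-large

    κ≡cardR₁ : toℕ κ ≡ cardR₁ w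
    κ≡cardR₁ = trans (toℕ-down q₁ m≤q₁) (sym cardR₁≡)

    facts : tOf v ≡ cardR₁ w + 1 × ¬ TypeR₁ v × (cardR₁ w ≡ 1 → ¬ TypeL₁ v)
    facts = trans t⁺≡block (trans (+-comm 1 (toℕ κ)) (cong (_+ 1) κ≡cardR₁))
                     , ¬TypeR₁-block
                     , λ card≡1 → ¬TypeL₁-block (trans κ≡cardR₁ card≡1)

  restricted-facts : ∀ {K} (v : Permutation′ K) → K ≡ suc k ∸ m →
    (∀ i j → toℕ i ≡ toℕ j + m → g (val w i) ≡ val v j + m) →
    tOf v ≡ cardR₁ w + 1 × ¬ TypeR₁ v × (cardR₁ w ≡ 1 → ¬ TypeL₁ v)
  restricted-facts {zero}  v 0≡ _ = ⊥-elim (<⇒≢ (m<n⇒0<n∸m (≤-<-trans m≤q₁ (FP.toℕ<n q₁))) 0≡)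
  restricted-facts {suc M} v M-eq v-rel = Restricted.facts v M-eq v-rel

  typeR₁-part : ∀ t → t ≡ a →
    Σ (Permutation′ (suc k ∸ (t ∸ 1))) (λ v →
       RestrictsTo (t ∸ 1) (λ i → sₜ t (w₀ t (toℕ (w ⟨$⟩ʳ i)))) v × AvoidsSix v ×
       tOf v ≡ cardR₁ w + 1 × ¬ TypeR₁ v × (cardR₁ w ≡ 1 → ¬ TypeL₁ v))
  typeR₁-part t refl =
    let v , restricts , avoids-v = relabelled in
    v , restricts , avoids-v , restricted-facts v refl (proj₂ restricts)

lemma3p8 : (n : ℕ) (w : Permutation′ (suc n)) → AvoidsSix w →
    (TypeN w →
      (∀ (i j : Fin (suc n)) → toℕ j ≡ w₀ (tOf w) (toℕ i) →
         toℕ (w ⟨$⟩ʳ j) ≡ w₀ (tOf w) (toℕ (w ⟨$⟩ʳ i))) ×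
      Σ (Permutation′ (suc n ∸ suc (tOf w))) (λ v →
         RestrictsTo (suc (tOf w)) (λ i → w₀ (tOf w) (toℕ (w ⟨$⟩ʳ i))) v × AvoidsSix v)) ×
    (TypeR₀ w →
      Σ (Permutation′ (suc n ∸ tOf w)) (λ v →
         RestrictsTo (tOf w) (λ i → w₀ (tOf w) (toℕ (w ⟨$⟩ʳ i))) v × AvoidsSix v)) ×
    (TypeR₁ w →
      Σ (Permutation′ (suc n ∸ (tOf w ∸ 1))) (λ v →
         RestrictsTo (tOf w ∸ 1) (λ i → sₜ (tOf w) (w₀ (tOf w) (toℕ (w ⟨$⟩ʳ i)))) v ×
         AvoidsSix v ×
         tOf v ≡ cardR₁ w + 1 ×
         ¬ TypeR₁ v ×
         (cardR₁ w ≡ 1 → ¬ TypeL₁ v)))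
lemma3p8 n w avoids =
    (λ (noR , noL) →
       TypeNCase.typeN-part w avoids noR noL (tOf w) (WithoutL.t⁺≡wOne w (proj₁ (proj₂ avoids)) noL))
  , (λ ((r , r∈R) , ¬R₁) →
       TypeRCase.typeR₀-part w avoids {r} r∈R ¬R₁ (tOf w) (TypeRCase.t⁺≡wOne w avoids {r} r∈R))
  , (λ (y₀ , y₀∈R₁) →
       TypeR₁Case.typeR₁-part w avoids {y₀} y₀∈R₁ (tOf w)
         (TypeRCase.t⁺≡wOne w avoids {y₀} (inR₁⇒inR w {y₀} y₀∈R₁)))
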